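{- Let $G$ be a graph with two distinct vertices $a,b$ and two nonempty vertex sets $V_a,V_b$ such that $\{a,b\}\subseteq N_G(v)$ for every $v\in V_a\cup V_b$. Let $T$ be a spanning tree of $G$ such that $V_a\subseteq N_T(a)$, $V_b\subseteq N_T(b)$ and $V(P^T_{a,b})\cap(V_a\cup V_b)=\emptyset$. Let $T_1$ and $T_2$ be the graphs with vertex set $V(T)$ and edge sets $E(T_1)=(E(T)\setminus\{bv\mid v\in V_b\})\cup\{av\mid v\in V_b\}$ and $E(T_2)=(E(T)\setminus\{av\mid v\in V_a\})\cup\{bv\mid v\in V_a\}$. Then $T_1$ and $T_2$ are spanning trees of $G$ and $\min(\mathrm{W}(T_1),\mathrm{W}(T_2))<\mathrm{W}(T)$.
   Context: Graphs are simple, undirected and unweighted. $N_H(v)$ is the open neighborhood of $v$ in $H$. For a tree $T$ and vertices $u,v$, $P^T_{u,v}$ denotes the unique $u$-$v$ path in $T$. The Wiener index is $\mathrm{W}(H)=\sum_{\{u,v\}\subseteq V(H)}\mathrm{dist}_H(u,v)$ (sum over unordered vertex pairs). -}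

module Defs where

open import Data.Nat using (ℕ; zero; suc; _≤_; _<ᵇ_)
open import Data.Bool using (Bool; true; false; _∧_; _∨_; not; if_then_else_)
open import Data.Fin using (Fin; toℕ; _≟_)
open import Data.Fin.Subset using (Subset; _∈_; _∪_)
open import Data.Fin.Subset.Properties using (_∈?_)
open import Data.List using (List; []; _∷_; _++_; [_]; length; head; last; allFin; map)
open import Data.Bool.ListAction using (any)
open import Data.Nat.ListAction using (sum)
open import Data.List.Relation.Unary.Linked using (Linked)
open import Data.List.Relation.Unary.Unique.Propositional using (Unique)
open import Data.Maybe using (just)
open import Data.Product using (Σ; _×_; ∃)
open import Relation.Binary.PropositionalEquality using (_≡_)
open import Relation.Nullary using (¬_; ⌊_⌋)

Adj : ℕ → Set
Adj n = Fin n → Fin n → Bool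

IsSimple : ∀ {n} → Adj n → Set
IsSimple {n} H = (∀ (x y : Fin n) → H x y ≡ H y x) × (∀ (x : Fin n) → H x x ≡ false)

Edge : ∀ {n} → Adj n → Fin n → Fin n → Set
Edge H x y = H x y ≡ true

IsPath : ∀ {n} → Adj n → Fin n → Fin n → List (Fin n) → Set
IsPath H u v p = Linked (Edge H) p × Unique p × head p ≡ just u × last p ≡ just v

IsCycle : ∀ {n} → Adj n → List (Fin n) → Set
IsCycle H p = 3 ≤ length p × Unique p × Σ _ (λ x → head p ≡ just x × Linked (Edge H) (p ++ [ x ]))

Connected : ∀ {n} → Adj n → Set
Connected {n} H = ∀ (u v : Fin n) → ∃ (λ p → IsPath H u v p)

Acyclic : ∀ {n} → Adj n → Set
Acyclic {n} H = ∀ (p : List (Fin n)) → ¬ IsCycle H p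

IsTree : ∀ {n} → Adj n → Set
IsTree H = IsSimple H × Connected H × Acyclic H

IsSpanningTree : ∀ {n} → Adj n → Adj n → Set
IsSpanningTree {n} G T = (∀ (x y : Fin n) → T x y ≡ true → G x y ≡ true) × IsTree T

reach : ∀ {n} → Adj n → ℕ → Fin n → Fin n → Bool
reach H zero u v = ⌊ u ≟ v ⌋
reach {n} H (suc k) u v = reach H k u v ∨ any (λ w → H u w ∧ reach H k w v) (allFin n)

searchDist : ∀ {n} → Adj n → Fin n → Fin n → ℕ → ℕ → ℕ
searchDist H u v k zero = k
searchDist H u v k (suc f) = if reach H k u v then k else searchDist H u v (suc k) f

-- graph distance = length of a shortest u-v walk (value n if v is unreachable from u,
-- which never happens in the connected graphs considered here)
dist : ∀ {n} → Adj n → Fin n → Fin n → ℕ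
dist {n} H u v = searchDist H u v 0 n

W : ∀ {n} → Adj n → ℕ
W {n} H = sum (map (λ u → sum (map (λ v → if toℕ u <ᵇ toℕ v then dist H u v else 0) (allFin n))) (allFin n))

starEdge : ∀ {n} → Fin n → Subset n → Fin n → Fin n → Bool
starEdge c S x y = (⌊ x ≟ c ⌋ ∧ ⌊ y ∈? S ⌋) ∨ (⌊ y ≟ c ⌋ ∧ ⌊ x ∈? S ⌋)

moveStar : ∀ {n} → Adj n → Fin n → Fin n → Subset n → Adj n
moveStar T c₁ c₂ S x y = (T x y ∧ not (starEdge c₁ S x y)) ∨ starEdge c₂ S x y

{-# OPTIONS --safe #-}
module Submission where

-- Let B be the set of vertices whose path to b enters b from Vb: these are the branches that T₁
-- reattaches from b to a. Distances in T₁ are those of T, except that between B and the rest the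
-- detour through b is replaced by one through a, so
--   W(T₁) − W(T) = |B| · Σ_{y ∉ B} (d(a,y) − d(b,y)),   and symmetrically
--   W(T₂) − W(T) = |A| · Σ_{y ∉ A} (d(b,y) − d(a,y)).
-- A vertex of B is exactly d(a,b) farther from a than from b, a vertex of A the other way round,
-- and B is nonempty; adding up, the two sums cannot both be nonnegative. That T₁ is a tree follows
-- from a height function (distance to a in T₁) along which every vertex but a has a unique parent.

open import Defs
open import Data.Bool using (Bool; true; false; T; _∧_; if_then_else_)
open import Data.Bool.Properties
  using (T-≡; T-∧; T-∨; ∧-comm; ∨-comm; ∨-zeroʳ; ∧-conicalˡ; ∧-conicalʳ)
open import Data.Empty using (⊥; ⊥-elim)
open import Data.Fin using (Fin; zero; suc; toℕ; _≟_)
open import Data.Fin.Properties using (injective⇒≤; toℕ-injective; any?)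
open import Data.Fin.Subset using (Subset; _∈_; _∉_; _∪_; Nonempty)
open import Data.Fin.Subset.Properties using (_∈?_; x∈p∪q⁺)
open import Data.List using (List; []; _∷_; _++_; [_]; length; last; lookup; allFin; map; tabulate)
open import Data.List.Membership.Propositional using (lose) renaming (_∈_ to _∈ₗ_; _∉_ to _∉ₗ_)
open import Data.List.Membership.Propositional.Properties using (∈-allFin; ∈-lookup)
open import Data.List.Relation.Unary.All as All using (All; []; _∷_)
import Data.List.Relation.Unary.All.Properties as All
open import Data.List.Relation.Unary.AllPairs using ([]; _∷_)
open import Data.List.Relation.Unary.Any using (here; there; satisfied)
open import Data.List.Relation.Unary.Any.Properties using (any⁺; any⁻)
open import Data.List.Relation.Unary.Linked as Linked using (Linked; []; [-]; _∷_)
import Data.List.Relation.Unary.Linked.Properties as Linked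
open import Data.List.Relation.Unary.Unique.Propositional using (Unique)
import Data.List.Relation.Unary.Unique.Propositional.Properties as Unique
open import Data.Maybe using (just)
open import Data.Maybe.Relation.Binary.Connected as Maybe using (just)
open import Data.Nat
  using (ℕ; zero; suc; _+_; _*_; _≤_; _<_; _⊓_; z≤n; s≤s; _<ᵇ_; _≤ᵇ_; ⌊_/2⌋; >-nonZero)
import Data.Nat as ℕ
open import Data.Nat.ListAction using () renaming (sum to sumₗ)
open import Data.Nat.Properties hiding (_≟_)
open import Algebra.Properties.CommutativeSemigroup +-commutativeSemigroup
  using (interchange; xy∙z≈xz∙y; xy∙z≈yz∙x)
open import Algebra.Properties.Semiring.Sum +-*-semiring
  using (sum-syntax; sum-cong-≗; sum-replicate-zero; ∑-distrib-+; ∑-comm; *-distribʳ-sum)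
open import Data.Product using (Σ; ∃; _×_; _,_; proj₁; proj₂)
open import Data.Sum using (_⊎_; inj₁; inj₂)
open import Data.Unit using (⊤; tt)
open import Function using (id; _∘_; Injective; Equivalence)
open import Relation.Binary.Definitions using (tri<; tri≈; tri>)
open import Relation.Binary.PropositionalEquality hiding ([_])
open import Relation.Nullary using (¬_; Dec; yes; no; ⌊_⌋)
open import Relation.Nullary.Decidable using (toWitness; fromWitness; _×-dec_; decidable-stable)

private variable
  n : ℕ

∧-true : ∀ {x y} → x ≡ true → y ≡ true → x ∧ y ≡ true
∧-true refl refl = refl

true≢false : true ≢ false
true≢false ()

dec-true⁺ : {P : Set} (p? : Dec P) → P → ⌊ p? ⌋ ≡ true
dec-true⁺ p? p = Equivalence.to T-≡ (fromWitness p)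

data Walk {n} (H : Adj n) : Fin n → Fin n → ℕ → Set where
  ε   : ∀ {u} → Walk H u u 0
  _◅_ : ∀ {u w v k} → Edge H u w → Walk H w v k → Walk H u v (suc k)

infixr 5 _◅_

module _ {H : Adj n} where

  vertices : ∀ {u v k} → Walk H u v k → List (Fin n)
  vertices {u = u} ε       = u ∷ []
  vertices {u = u} (_ ◅ w) = u ∷ vertices w

  length-vertices : ∀ {u v k} (w : Walk H u v k) → length (vertices w) ≡ suc k
  length-vertices ε       = refl
  length-vertices (_ ◅ w) = cong suc (length-vertices w)

  _++ʷ_ : ∀ {u v w k j} → Walk H u v k → Walk H v w j → Walk H u w (k + j)
  ε       ++ʷ q = q
  (e ◅ p) ++ʷ q = e ◅ (p ++ʷ q)

  _▻_ : ∀ {u v w k} → Walk H u v k → Edge H v w → Walk H u w (suc k)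
  ε       ▻ e = e ◅ ε
  (e′ ◅ p) ▻ e = e′ ◅ (p ▻ e)

  start∈vertices : ∀ {u v k} (w : Walk H u v k) → u ∈ₗ vertices w
  start∈vertices ε       = here refl
  start∈vertices (_ ◅ _) = here refl

  end∈vertices-▻ : ∀ {u v w k} (p : Walk H u v k) (e : Edge H v w) → v ∈ₗ vertices (p ▻ e)
  end∈vertices-▻ ε        e = here refl
  end∈vertices-▻ (_ ◅ p)  e = there (end∈vertices-▻ p e)

Undirected : Adj n → Set
Undirected {n} H = ∀ (x y : Fin n) → H x y ≡ H y x

WalkConnected : Adj n → Set
WalkConnected {n} H = ∀ (u v : Fin n) → ∃ λ k → Walk H u v k

module _ {H : Adj n} (undirected : Undirected H) where

  flip-edge : ∀ {x y} → Edge H x y → Edge H y x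
  flip-edge {x} {y} e = trans (undirected y x) e

  reverse : ∀ {u v k} → Walk H u v k → Walk H v u k
  reverse ε       = ε
  reverse (e ◅ p) = reverse p ▻ flip-edge e

module _ {H : Adj n} where

  reach-sound : ∀ k {u v} → T (reach H k u v) → ∃ λ j → j ≤ k × Walk H u v j
  reach-sound zero {u} {v} r with refl ← toWitness {a? = u ≟ v} r = 0 , z≤n , ε
  reach-sound (suc k) r with Equivalence.to T-∨ r
  ... | inj₁ r′ = let j , j≤k , w = reach-sound k r′ in j , m≤n⇒m≤1+n j≤k , w
  ... | inj₂ r′ with satisfied (any⁻ (λ x → H _ x ∧ reach H k x _) (allFin n) r′)
  ...   | x , p with Equivalence.to T-∧ p
  ...     | e , r″ = let j , j≤k , w = reach-sound k r″ in
                     suc j , s≤s j≤k , Equivalence.to T-≡ e ◅ w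

  reach-complete : ∀ k {u v j} → j ≤ k → Walk H u v j → T (reach H k u v)
  reach-complete zero    z≤n ε = fromWitness refl
  reach-complete (suc k) z≤n ε = Equivalence.from T-∨ (inj₁ (reach-complete k z≤n ε))
  reach-complete (suc k) (s≤s j≤k) (_◅_ {w = x} e w) =
    Equivalence.from T-∨ (inj₂ (any⁺ (λ y → H _ y ∧ reach H k y _) (lose (∈-allFin x)
      (Equivalence.from T-∧ (Equivalence.from T-≡ e , reach-complete k j≤k w)))))

  searchDist-≤ : ∀ {u v} k f {j} → k ≤ j → T (reach H j u v) → searchDist H u v k f ≤ j
  searchDist-≤ k zero    k≤j r = k≤j
  searchDist-≤ {u} {v} k (suc f) k≤j r with reach H k u v in eq
  ... | true  = k≤j
  ... | false = searchDist-≤ (suc k) f (≤∧≢⇒< k≤j λ { refl → subst T eq r }) r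

  searchDist-reach : ∀ {u v} k f {j} → k ≤ j → j < k + f → T (reach H j u v) →
                     T (reach H (searchDist H u v k f) u v)
  searchDist-reach k zero k≤j j<k r = ⊥-elim (<⇒≱ j<k (subst (_≤ _) (sym (+-identityʳ k)) k≤j))
  searchDist-reach {u} {v} k (suc f) {j} k≤j j<k+f r with reach H k u v in eq
  ... | true  = subst T (sym eq) tt
  ... | false = searchDist-reach (suc k) f (≤∧≢⇒< k≤j λ { refl → subst T eq r })
                  (subst (j <_) (+-suc k f) j<k+f) r

lookup-injective : {A : Set} {xs : List A} → Unique xs → Injective _≡_ _≡_ (lookup xs)
lookup-injective (x∉xs ∷ _) {zero}  {zero}  _  = refl
lookup-injective (x∉xs ∷ _) {zero}  {suc j} eq = ⊥-elim (All.lookup x∉xs (∈-lookup j) eq)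
lookup-injective (x∉xs ∷ _) {suc i} {zero}  eq = ⊥-elim (All.lookup x∉xs (∈-lookup i) (sym eq))
lookup-injective (_ ∷ u)    {suc i} {suc j} eq = cong suc (lookup-injective u eq)

length-unique-≤ : {xs : List (Fin n)} → Unique xs → length xs ≤ n
length-unique-≤ u = injective⇒≤ (lookup-injective u)

module _ {H : Adj n} where

  Shortest : ∀ {u v k} → Walk H u v k → Set
  Shortest {u} {v} {k} _ = ∀ {m} → Walk H u v m → k ≤ m

  suffix : ∀ {u v x k} (w : Walk H u v k) → x ∈ₗ vertices w → ∃ λ j → j ≤ k × Walk H x v j
  suffix ε       (here refl) = 0 , z≤n , ε
  suffix (e ◅ w) (here refl) = _ , ≤-refl , e ◅ w
  suffix (e ◅ w) (there x∈w) = let j , j≤k , w′ = suffix w x∈w in j , m≤n⇒m≤1+n j≤k , w′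

  shortest-unique : ∀ {u v k} (w : Walk H u v k) → Shortest w → Unique (vertices w)
  shortest-unique ε       _  = [] ∷ []
  shortest-unique {u} (e ◅ w) sh =
    All.¬Any⇒All¬ (vertices w) u∉w ∷ shortest-unique w (≤-pred ∘ sh ∘ (e ◅_))
    where
    u∉w : u ∉ₗ vertices w
    u∉w u∈w = let j , j≤k , w′ = suffix w u∈w in <⇒≱ (s≤s j≤k) (sh w′)

  -- Opaque: these proof terms are huge when unfolded, and a later with-abstraction over a
  -- distance fact would otherwise normalise them.
  opaque
    shortest-walk : ∀ {u v L} → Walk H u v L → ∃ λ k → Σ (Walk H u v k) Shortest
    shortest-walk {u} {v} {L} w =
      let j , j≤i , wⱼ = reach-sound _ (searchDist-reach 0 (suc L) z≤n ≤-refl (reach-complete L ≤-refl w))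
      in j , wⱼ , λ wₘ → ≤-trans j≤i (searchDist-≤ 0 (suc L) z≤n (reach-complete _ ≤-refl wₘ))

    dist-shortest : ∀ {u v k} (w : Walk H u v k) → Shortest w → dist H u v ≡ k
    dist-shortest {u} {v} {k} w sh = ≤-antisym dist≤k k≤dist
      where
      k<n : k < n
      k<n = subst (_≤ n) (length-vertices w) (length-unique-≤ (shortest-unique w sh))
      dist≤k : dist H u v ≤ k
      dist≤k = searchDist-≤ 0 n z≤n (reach-complete k ≤-refl w)
      k≤dist : k ≤ dist H u v
      k≤dist = let j , j≤dist , wⱼ = reach-sound _ (searchDist-reach 0 n z≤n k<n (reach-complete k ≤-refl w))
               in ≤-trans (sh wⱼ) j≤dist

    dist-walk : ∀ {u v L} → Walk H u v L → Walk H u v (dist H u v)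
    dist-walk w = let _ , w′ , sh = shortest-walk w in subst (Walk H _ _) (sym (dist-shortest w′ sh)) w′

    dist-≤-walk : ∀ {u v L} → Walk H u v L → dist H u v ≤ L
    dist-≤-walk w = let _ , w′ , sh = shortest-walk w in ≤-trans (≤-reflexive (dist-shortest w′ sh)) (sh w)

module _ {H : Adj n} where

  dist-self : ∀ u → dist H u u ≡ 0
  dist-self u = n≤0⇒n≡0 (dist-≤-walk (ε {u = u}))

  module Distances (undirected : Undirected H) (connected : WalkConnected H) where

    d : Fin n → Fin n → ℕ
    d = dist H

    geodesic : ∀ u v → Walk H u v (d u v)
    geodesic u v = dist-walk (proj₂ (connected u v))

    d≡0⇒≡ : ∀ {u v} → d u v ≡ 0 → u ≡ v
    d≡0⇒≡ {u} {v} eq with ε ← subst (Walk H u v) eq (geodesic u v) = refl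

    d-sym : ∀ u v → d u v ≡ d v u
    d-sym u v = ≤-antisym (dist-≤-walk (reverse undirected (geodesic v u)))
                          (dist-≤-walk (reverse undirected (geodesic u v)))

    d-triangle : ∀ u v w → d u w ≤ d u v + d v w
    d-triangle u v w = dist-≤-walk (geodesic u v ++ʷ geodesic v w)

    d-edge : ∀ {u w} v → Edge H u w → d u v ≤ suc (d w v)
    d-edge {w = w} v e = dist-≤-walk (e ◅ geodesic w v)

    d-step : ∀ {u v} → u ≢ v → ∃ λ z → Edge H u z × d u v ≡ suc (d z v)
    d-step {u} {v} u≢v = step (geodesic u v) refl
      where
      step : ∀ {k} → Walk H u v k → k ≡ d u v → ∃ λ z → Edge H u z × d u v ≡ suc (d z v)
      step ε            _  = ⊥-elim (u≢v refl)
      step (_◅_ {w = z} e w) eq =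
        z , e , ≤-antisym (d-edge v e) (subst (suc (d z v) ≤_) eq (s≤s (dist-≤-walk w)))

last-∷ʳ : {A : Set} (xs : List A) (x : A) → last (xs ++ [ x ]) ≡ just x
last-∷ʳ []           x = refl
last-∷ʳ (_ ∷ [])     x = refl
last-∷ʳ (_ ∷ y ∷ xs) x = last-∷ʳ (y ∷ xs) x

module _ {H : Adj n} where

  vertices-linked : ∀ {u v k} (w : Walk H u v k) → Linked (Edge H) (vertices w)
  vertices-linked ε             = [-]
  vertices-linked (e ◅ ε)       = e ∷ [-]
  vertices-linked (e ◅ e′ ◅ w)  = e ∷ vertices-linked (e′ ◅ w)

  last-vertices : ∀ {u v k} (w : Walk H u v k) → last (vertices w) ≡ just v
  last-vertices ε            = refl
  last-vertices (e ◅ ε)      = refl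
  last-vertices (e ◅ e′ ◅ w) = last-vertices (e′ ◅ w)

  shortest-path : ∀ {u v k} (w : Walk H u v k) → Shortest w → IsPath H u v (vertices w)
  shortest-path ε       sh = [-] , shortest-unique ε sh , refl , refl
  shortest-path (e ◅ w) sh = vertices-linked (e ◅ w) , shortest-unique (e ◅ w) sh , refl , last-vertices (e ◅ w)

  path-walk : ∀ {u v} (p : List (Fin n)) → IsPath H u v p → ∃ λ k → Walk H u v k
  path-walk (x ∷ [])     ([-] , _ , refl , refl) = 0 , ε
  path-walk (x ∷ y ∷ p) (e ∷ l , _ ∷ u , refl , lst) =
    let k , w = path-walk (y ∷ p) (l , u , refl , lst) in suc k , e ◅ w

  path-▻ : ∀ {u v w} {p : List (Fin n)} → IsPath H u v p → All (_≢ w) p → Edge H v w →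
           IsPath H u w (p ++ [ w ])
  path-▻ {w = w} {p = x ∷ p} (l , u , refl , lst) p≢w e =
    Linked.++⁺ l (subst (λ m → Maybe.Connected (Edge H) m (just w)) (sym lst) (just e)) [-] ,
    Unique.++⁺ u ([] ∷ []) (λ { (x∈p , here refl) → All.lookup p≢w x∈p refl }) ,
    refl , last-∷ʳ (x ∷ p) w

  close-path : ∀ {x y z} {q : List (Fin n)} → IsPath H y z q → All (x ≢_) q →
               Edge H x y → Edge H z x → y ≢ z → IsCycle H (x ∷ q)
  close-path {q = y ∷ []} (_ , _ , refl , refl) _ _ _ y≢z = ⊥-elim (y≢z refl)
  close-path {x} {q = y ∷ y′ ∷ q} path@(_ , u , refl , _) x∉q exy ezx _ =
    s≤s (s≤s (s≤s z≤n)) , x∉q ∷ u , x , refl ,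
    exy ∷ proj₁ (path-▻ path (All.map (_∘ sym) x∉q) ezx)

connected⇒walkConnected : {H : Adj n} → Connected H → WalkConnected H
connected⇒walkConnected c u v = let p , path = c u v in path-walk p path

walkConnected⇒connected : {H : Adj n} → WalkConnected H → Connected H
walkConnected⇒connected c u v =
  let _ , w = c u v ; _ , w′ , sh = shortest-walk w in vertices w′ , shortest-path w′ sh

induced : Adj n → (Fin n → Bool) → Adj n
induced H P x y = H x y ∧ (P x ∧ P y)

module _ {H : Adj n} (P : Fin n → Bool) where

  induced-undirected : Undirected H → Undirected (induced H P)
  induced-undirected undirected x y = cong₂ _∧_ (undirected x y) (∧-comm (P x) (P y))

  induced⇒edge : ∀ {x y} → Edge (induced H P) x y → Edge H x y
  induced⇒edge {x} {y} e = ∧-conicalˡ (H x y) _ e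

  induce : ∀ {u v k} (w : Walk H u v k) → All (λ x → P x ≡ true) (vertices w) → Walk (induced H P) u v k
  induce ε             _                = ε
  induce (e ◅ ε)       (pu ∷ pv ∷ [])   = ∧-true e (∧-true pu pv) ◅ ε
  induce (e ◅ e′ ◅ w)  (pu ∷ pw ∷ ps)   = ∧-true e (∧-true pu pw) ◅ induce (e′ ◅ w) (pw ∷ ps)

  induced-vertices : ∀ {u v k} (w : Walk (induced H P) u v k) → P u ≡ true →
                     All (λ x → P x ≡ true) (vertices w)
  induced-vertices ε       pu = pu ∷ []
  induced-vertices {u} (_◅_ {w = z} e w) pu =
    pu ∷ induced-vertices w (∧-conicalʳ (P u) (P z) (∧-conicalʳ (H u z) _ e))

  path-within : ∀ {u v k} → Walk (induced H P) u v k → P u ≡ true →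
                ∃ λ q → IsPath H u v q × All (λ x → P x ≡ true) q
  path-within w pu =
    let _ , w′ , sh = shortest-walk w ; l , u , hd , lst = shortest-path w′ sh in
    vertices w′ , (Linked.map induced⇒edge l , u , hd , lst) , induced-vertices w′ pu

<ᵇ-false : ∀ {i j} → ¬ i < j → (i <ᵇ j) ≡ false
<ᵇ-false {i} {j} i≮j with i <ᵇ j in eq
... | false = refl
... | true  = ⊥-elim (i≮j (<ᵇ⇒< i j (Equivalence.from T-≡ eq)))

adjacent-levels : ∀ {i j} → i ≤ suc j → j ≤ suc i → i ≢ j → i ≡ suc j ⊎ j ≡ suc i
adjacent-levels {i} {j} i≤1+j j≤1+i i≢j with <-cmp i j
... | tri< i<j _ _ = inj₂ (≤-antisym j≤1+i i<j)
... | tri≈ _ i≡j _ = ⊥-elim (i≢j i≡j)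
... | tri> _ _ j<i = inj₁ (≤-antisym i≤1+j j<i)

module Tree {T : Adj n} (tree : IsTree T) where

  undirected : Undirected T
  undirected = proj₁ (proj₁ tree)

  loopless : ∀ x → T x x ≡ false
  loopless = proj₂ (proj₁ tree)

  acyclic : Acyclic T
  acyclic = proj₂ (proj₂ tree)

  walkConnected : WalkConnected T
  walkConnected = connected⇒walkConnected (proj₁ (proj₂ tree))

  open Distances undirected walkConnected public

  edge-≢ : ∀ {x y} → Edge T x y → x ≢ y
  edge-≢ {x} e refl with () ← trans (sym e) (loopless x)

  d-adjacent : ∀ {x y} → Edge T x y → d x y ≡ 1
  d-adjacent {x} {y} e with d x y in eq
  ... | zero  = ⊥-elim (edge-≢ e (d≡0⇒≡ eq))
  ... | suc k = cong suc (n≤0⇒n≡0 (≤-pred (subst (_≤ 1) eq (dist-≤-walk {H = T} (e ◅ ε)))))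

  within : Fin n → ℕ → Fin n → Bool
  within r k x = d x r ≤ᵇ k

  within-ball : ∀ {r k x} → d x r ≤ k → within r k x ≡ true
  within-ball le = Equivalence.to T-≡ (≤⇒≤ᵇ le)

  ball-path : ∀ r k {y z} → d y r ≤ k → d z r ≤ k →
              ∃ λ q → IsPath T y z q × All (λ x → within r k x ≡ true) q
  ball-path r k {y} {z} y≤k z≤k =
    path-within (within r k)
      (lift y≤k ++ʷ reverse (induced-undirected (within r k) undirected) (lift z≤k)) (within-ball y≤k)
    where
    lift : ∀ {x} → d x r ≤ k → Walk (induced T (within r k)) x r (d x r)
    lift {x} x≤k = induce (within r k) (geodesic x r) (All.tabulate λ x′∈w →
      let j , j≤ , w′ = suffix (geodesic x r) x′∈w
      in within-ball (≤-trans (dist-≤-walk w′) (≤-trans j≤ x≤k)))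

  outside-ball : ∀ {r k x y} → d x r ≡ suc k → within r k y ≡ true → x ≢ y
  outside-ball {r} {k} {x} eq wy refl = <⇒≱ (≤-reflexive (sym eq)) (≤ᵇ⇒≤ _ _ (Equivalence.from T-≡ wy))

  -- Two parents of x are joined by a path inside the ball below x, and x closes it to a cycle.
  parent-unique : ∀ r {x y z} → Edge T x y → Edge T x z →
                  d x r ≡ suc (d y r) → d x r ≡ suc (d z r) → y ≡ z
  parent-unique r {x} {y} {z} exy exz ey ez with y ≟ z
  ... | yes y≡z = y≡z
  ... | no  y≢z =
    let k = d y r
        q , path , low = ball-path r k ≤-refl (≤-reflexive (suc-injective (trans (sym ez) ey)))
    in ⊥-elim (acyclic (x ∷ q)
                 (close-path path (All.map (outside-ball ey) low) exy (flip-edge undirected exz) y≢z))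

  -- For an edge x–y within a level, the parents x′, y′ are joined inside the ball below, and
  -- x x′ … y′ y is a cycle.
  no-level : ∀ r {x y} → Edge T x y → d x r ≢ d y r
  no-level r {x} {y} exy eq with d x r in ex
  ... | zero  = edge-≢ exy (trans (d≡0⇒≡ ex) (sym (d≡0⇒≡ (sym eq))))
  ... | suc k =
    let x′ , exx′ , dx = d-step {x} {r} (λ { refl → 0≢1+n (trans (sym (dist-self r)) ex) })
        y′ , eyy′ , dy = d-step {y} {r} (λ { refl → 0≢1+n (trans (sym (dist-self r)) (sym eq)) })
        x′≤k = ≤-reflexive (suc-injective (trans (sym dx) ex))
        q , path , low = ball-path r k x′≤k (≤-reflexive (suc-injective (trans (sym dy) (sym eq))))
        path′ = path-▻ path (All.map (λ w → outside-ball (sym eq) w ∘ sym) low) (flip-edge undirected eyy′)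
        x∉path′ = All.++⁺ (All.map (outside-ball ex) low) (edge-≢ exy ∷ [])
        x′≢y = outside-ball (sym eq) (within-ball x′≤k) ∘ sym
    in acyclic (x ∷ q ++ [ y ]) (close-path path′ x∉path′ exx′ (flip-edge undirected exy) x′≢y)

  edge-level : ∀ r {x y} → Edge T x y → d x r ≡ suc (d y r) ⊎ d y r ≡ suc (d x r)
  edge-level r e = adjacent-levels (d-edge r e) (d-edge r (flip-edge undirected e)) (no-level r e)

  geodesic-path : ∀ {u w k} (p : Walk T u w k) → k ≡ d u w → IsPath T u w (vertices p)
  geodesic-path p k≡d = shortest-path p (λ q → subst (_≤ _) (sym k≡d) (dist-≤-walk q))

  path-via-last : ∀ {u v w} → Edge T v w → d u w ≡ suc (d u v) → ∃ λ p → IsPath T u w p × v ∈ₗ p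
  path-via-last {u} {v} e eq = _ , geodesic-path (geodesic u v ▻ e) (sym eq) , end∈vertices-▻ (geodesic u v) e

  path-via-first : ∀ {u v w} → Edge T u v → d u w ≡ suc (d v w) → ∃ λ p → IsPath T u w p × v ∈ₗ p
  path-via-first {v = v} {w} e eq =
    _ , geodesic-path (e ◅ geodesic v w) (sym eq) , there (start∈vertices (geodesic v w))

module _ {A : Set} where

  last⁺ : A → List A → A
  last⁺ x []      = x
  last⁺ _ (y ∷ l) = last⁺ y l

  penultimate : A → A → List A → A
  penultimate x _ []      = x
  penultimate _ y (z ∷ l) = penultimate y z l

  last⁺-∷ʳ : ∀ x (l : List A) z → last⁺ x (l ++ [ z ]) ≡ z
  last⁺-∷ʳ x []      z = refl
  last⁺-∷ʳ _ (y ∷ l) z = last⁺-∷ʳ y l z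

  penultimate-∷ʳ : ∀ x y (l : List A) z → penultimate x y (l ++ [ z ]) ≡ last⁺ y l
  penultimate-∷ʳ x y []      z = refl
  penultimate-∷ʳ _ y (z ∷ l) w = penultimate-∷ʳ y z l w

  last⁺-∈ : ∀ x (l : List A) → last⁺ x l ∈ₗ x ∷ l
  last⁺-∈ x []      = here refl
  last⁺-∈ _ (y ∷ l) = there (last⁺-∈ y l)

  linked-last : ∀ {R : A → A → Set} x y l → Linked R (x ∷ y ∷ l) → R (penultimate x y l) (last⁺ y l)
  linked-last x y []      (r ∷ _) = r
  linked-last _ y (z ∷ l) (_ ∷ rs) = linked-last y z l rs

  NonBacktracking : List A → Set
  NonBacktracking (x ∷ y ∷ z ∷ l) = x ≢ z × NonBacktracking (y ∷ z ∷ l)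
  NonBacktracking _               = ⊤

  unique-nonBacktracking : ∀ {l : List A} {z} → Unique l → All (_≢ z) l → NonBacktracking (l ++ [ z ])
  unique-nonBacktracking {[]}              _                     _ = tt
  unique-nonBacktracking {_ ∷ []}          _                     _ = tt
  unique-nonBacktracking {_ ∷ _ ∷ []}      _                     (x≢z ∷ _) = x≢z , tt
  unique-nonBacktracking {_ ∷ _ ∷ _ ∷ _}   ((_ ∷ x≢z ∷ _) ∷ u) (_ ∷ l≢z) =
    x≢z , unique-nonBacktracking u l≢z

record Graded (H : Adj n) (h : Fin n → ℕ) : Set where
  field
    edge-level    : ∀ {x y} → Edge H x y → h x ≡ suc (h y) ⊎ h y ≡ suc (h x)
    parent-unique : ∀ {x y z} → Edge H x y → Edge H x z → h x ≡ suc (h y) → h x ≡ suc (h z) → y ≡ z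

module _ {H : Adj n} {h : Fin n → ℕ} (undirected : Undirected H) (graded : Graded H h) where

  open Graded graded

  NonBacktrackingWalk : List (Fin n) → Set
  NonBacktrackingWalk l = Linked (Edge H) l × NonBacktracking l

  once-up-always-up : ∀ x y l → NonBacktrackingWalk (x ∷ y ∷ l) → h y ≡ suc (h x) →
                      h x < h (last⁺ y l) × h (last⁺ y l) ≡ suc (h (penultimate x y l))
  once-up-always-up x y []      _ up = ≤-reflexive (sym up) , up
  once-up-always-up x y (z ∷ l) (exy ∷ rest@(eyz ∷ _) , x≢z , nb) up with edge-level eyz
  ... | inj₁ down = ⊥-elim (x≢z (parent-unique (flip-edge undirected exy) eyz up down))
  ... | inj₂ up′  = let lt , last-up = once-up-always-up y z l (rest , nb) up′ in
                    <-trans (≤-reflexive (sym up)) lt , last-up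

  valley : ∀ x y l → NonBacktrackingWalk (x ∷ y ∷ l) →
           h (last⁺ y l) < h x ⊎ h (last⁺ y l) ≡ suc (h (penultimate x y l))
  valley x y l (exy ∷ rest , nb) with edge-level exy
  valley x y l (exy ∷ rest , nb) | inj₂ up = inj₂ (proj₂ (once-up-always-up x y l (exy ∷ rest , nb) up))
  valley x y []      (exy ∷ rest , nb)       | inj₁ down = inj₁ (≤-reflexive (sym down))
  valley x y (z ∷ l) (exy ∷ rest , _ , nb)   | inj₁ down with valley y z l (rest , nb)
  ... | inj₁ lt      = inj₁ (<-trans lt (≤-reflexive (sym down)))
  ... | inj₂ last-up = inj₂ last-up

  -- Around a cycle from x, a graded walk without backtracking first descends, then only ascends;
  -- so it returns to x from a second parent of x.
  graded⇒acyclic : Acyclic H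
  graded⇒acyclic (_ ∷ [])     (s≤s () , _)
  graded⇒acyclic (_ ∷ _ ∷ []) (s≤s (s≤s ()) , _)
  graded⇒acyclic (x ∷ y ∷ z ∷ l) (_ , x∉ ∷ u@(y∉ ∷ _) , _ , refl , closed@(exy ∷ _)) =
    contradiction (edge-level exy) (valley x y l′ around)
    where
    l′ = (z ∷ l) ++ [ x ]
    around : NonBacktrackingWalk (x ∷ y ∷ l′)
    around = closed , All.lookup x∉ (there (here refl)) , unique-nonBacktracking u (All.map (_∘ sym) x∉)
    x-last : last⁺ y l′ ≡ x
    x-last = last⁺-∷ʳ y (z ∷ l) x
    p-last : penultimate x y l′ ≡ last⁺ z l
    p-last = penultimate-∷ʳ x y (z ∷ l) x
    contradiction : h x ≡ suc (h y) ⊎ h y ≡ suc (h x) →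
                    h (last⁺ y l′) < h x ⊎ h (last⁺ y l′) ≡ suc (h (penultimate x y l′)) → ⊥
    contradiction (inj₂ up)   _ =
      <-irrefl refl (subst (λ w → h x < h w) x-last (proj₁ (once-up-always-up x y l′ around up)))
    contradiction (inj₁ down) (inj₁ lt) = <-irrefl refl (subst (λ w → h w < h x) x-last lt)
    contradiction (inj₁ down) (inj₂ last-up) = All.lookup y∉ (last⁺-∈ z l) (sym p≡y)
      where
      p≡y : last⁺ z l ≡ y
      p≡y = parent-unique (flip-edge undirected (subst₂ (Edge H) p-last x-last (linked-last x y l′ closed)))
              exy (subst₂ (λ a b → h a ≡ suc (h b)) x-last p-last last-up) down

module _ {H : Adj n} (y : Fin n) (D : Fin n → ℕ) (D-target : D y ≡ 0)
         (D-lipschitz : ∀ {x z} → Edge H x z → D x ≤ suc (D z))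
         (D-descent : ∀ {x} → x ≢ y → ∃ λ z → Edge H x z × D x ≡ suc (D z)) where

  potential-walk : ∀ x → Walk H x y (D x)
  potential-walk x = go (D x) x refl
    where
    go : ∀ k x → D x ≡ k → Walk H x y k
    go k x eq with x ≟ y
    go zero    x eq | yes refl = ε
    go (suc k) x eq | yes refl = ⊥-elim (0≢1+n (trans (sym D-target) eq))
    go k       x eq | no x≢y with D-descent x≢y
    go zero    x eq | no x≢y | z , e , eqz = ⊥-elim (0≢1+n (trans (sym eq) eqz))
    go (suc k) x eq | no x≢y | z , e , eqz = e ◅ go k z (suc-injective (trans (sym eqz) eq))

  potential≤length : ∀ {x L} → Walk H x y L → D x ≤ L
  potential≤length ε       = ≤-reflexive D-target
  potential≤length (e ◅ w) = ≤-trans (D-lipschitz e) (s≤s (potential≤length w))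

  dist≡potential : ∀ x → dist H x y ≡ D x
  dist≡potential x =
    ≤-antisym (dist-≤-walk (potential-walk x)) (potential≤length (dist-walk (potential-walk x)))

∑∑ : (Fin n → Fin n → ℕ) → ℕ
∑∑ {n} F = ∑[ x < n ] ∑[ y < n ] F x y

sum-map-tabulate : {A : Set} (f : A → ℕ) (g : Fin n → A) → sumₗ (map f (tabulate g)) ≡ ∑[ i < n ] f (g i)
sum-map-tabulate {zero}  f g = refl
sum-map-tabulate {suc n} f g = cong (f (g zero) +_) (sum-map-tabulate f (g ∘ suc))

below : (Fin n → Fin n → ℕ) → Fin n → Fin n → ℕ
below f u v = if toℕ u <ᵇ toℕ v then f u v else 0

W≡∑∑below : (H : Adj n) → W H ≡ ∑∑ (below (dist H))
W≡∑∑below {n} H =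
  trans (sum-map-tabulate (λ u → sumₗ (map (below (dist H) u) (allFin n))) id)
        (sum-cong-≗ (λ u → sum-map-tabulate (below (dist H) u) id))

∑∑-distrib-+ : (F G : Fin n → Fin n → ℕ) → ∑∑ (λ x y → F x y + G x y) ≡ ∑∑ F + ∑∑ G
∑∑-distrib-+ {n} F G =
  trans (sum-cong-≗ (λ x → ∑-distrib-+ (F x) (G x)))
        (∑-distrib-+ (λ x → ∑[ y < n ] F x y) (λ x → ∑[ y < n ] G x y))

module _ (f : Fin n → Fin n → ℕ) (f-sym : ∀ u v → f u v ≡ f v u) (f-diag : ∀ u → f u u ≡ 0) where

  below-split : ∀ u v → f u v ≡ below f u v + below f v u
  below-split u v with <-cmp (toℕ u) (toℕ v)
  ... | tri< u<v _ v≮u rewrite Equivalence.to T-≡ (<⇒<ᵇ u<v) | <ᵇ-false v≮u = sym (+-identityʳ _)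
  ... | tri> u≮v _ v<u rewrite Equivalence.to T-≡ (<⇒<ᵇ v<u) | <ᵇ-false u≮v = f-sym u v
  ... | tri≈ u≮v u≡v v≮u rewrite <ᵇ-false u≮v | <ᵇ-false v≮u | toℕ-injective u≡v = f-diag v

  ∑∑-symmetric : ∑∑ f ≡ ∑∑ (below f) + ∑∑ (below f)
  ∑∑-symmetric = begin
    ∑∑ f                                ≡⟨ sum-cong-≗ (λ u → sum-cong-≗ (below-split u)) ⟩
    ∑∑ (λ u v → below f u v + flipped u v) ≡⟨ ∑∑-distrib-+ (below f) flipped ⟩
    ∑∑ (below f) + ∑∑ flipped           ≡⟨ cong (∑∑ (below f) +_) (∑-comm flipped) ⟩
    ∑∑ (below f) + ∑∑ (below f)         ∎
    where
    open ≡-Reasoning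
    flipped : Fin n → Fin n → ℕ
    flipped u v = below f v u

W-doubled : {H : Adj n} → Undirected H → WalkConnected H → W H + W H ≡ ∑∑ (dist H)
W-doubled {H = H} undirected connected =
  sym (trans (∑∑-symmetric (dist H) (Distances.d-sym undirected connected) dist-self)
             (cong₂ _+_ (sym (W≡∑∑below H)) (sym (W≡∑∑below H))))

when : Bool → ℕ → ℕ
when p m = if p then m else 0

unless : Bool → ℕ → ℕ
unless p m = if p then 0 else m

count : (Fin n → Bool) → ℕ
count {n} p = ∑[ x < n ] when (p x) 1

∑-mono-≤ : {f g : Fin n → ℕ} → (∀ i → f i ≤ g i) → ∑[ i < n ] f i ≤ ∑[ i < n ] g i
∑-mono-≤ {zero}  f≤g = z≤n
∑-mono-≤ {suc n} f≤g = +-mono-≤ (f≤g zero) (∑-mono-≤ (f≤g ∘ suc))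

term≤∑ : (f : Fin n → ℕ) (i : Fin n) → f i ≤ ∑[ j < n ] f j
term≤∑ f zero    = m≤m+n (f zero) _
term≤∑ f (suc i) = ≤-trans (term≤∑ (f ∘ suc) i) (m≤n+m _ (f zero))

count-pos : ∀ (p : Fin n → Bool) {i} → p i ≡ true → 0 < count p
count-pos p {i} pi = subst (λ q → when q 1 ≤ count p) pi (term≤∑ (λ x → when (p x) 1) i)

∑-when : ∀ q (g : Fin n → ℕ) → ∑[ y < n ] when q (g y) ≡ when q (∑[ y < n ] g y)
∑-when true  g = refl
∑-when {n} false g = sum-replicate-zero n

∑-when-const : (p : Fin n → Bool) (m : ℕ) → ∑[ x < n ] when (p x) m ≡ count p * m
∑-when-const {n} p m = trans (sum-cong-≗ when≡) (sym (*-distribʳ-sum m (λ x → when (p x) 1)))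
  where
  when≡ : ∀ x → when (p x) m ≡ when (p x) 1 * m
  when≡ x with p x
  ... | true  = sym (*-identityˡ m)
  ... | false = refl

∑∑-when : (p : Fin n → Bool) (g : Fin n → ℕ) →
          ∑∑ (λ x y → when (p x) (g y)) ≡ count p * ∑[ y < n ] g y
∑∑-when p g = trans (sum-cong-≗ (λ x → ∑-when (p x) g)) (∑-when-const p _)

+-double-injective : ∀ {m k} → m + m ≡ k + k → m ≡ k
+-double-injective {m} {k} eq = trans (n≡⌊n+n/2⌋ m) (trans (cong ⌊_/2⌋ eq) (sym (n≡⌊n+n/2⌋ k)))

-- The arithmetic core of the theorem: da, db are the distances to a and b, and A, B the vertices
-- behind Va and behind Vb.
no-double-improvement : (da db : Fin n → ℕ) (A B : Fin n → Bool) {δ : ℕ} → 0 < δ →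
  (∀ {y} → A y ≡ true → db y ≡ δ + da y) →
  (∀ {y} → B y ≡ true → da y ≡ δ + db y) → 0 < count B →
  ∑[ y < n ] unless (B y) (db y) ≤ ∑[ y < n ] unless (B y) (da y) →
  ∑[ y < n ] unless (A y) (da y) ≤ ∑[ y < n ] unless (A y) (db y) → ⊥
no-double-improvement {n} da db A B {δ} δ>0 A⇒ B⇒ count>0 B-nonimproving A-nonimproving =
  <⇒≱ count>0 (+-cancelˡ-≤ (∑[ y < n ] R y) _ _ (begin
    ∑[ y < n ] R y + count B          ≡⟨ sym (∑-distrib-+ R (λ y → when (B y) 1)) ⟩
    ∑[ y < n ] (R y + when (B y) 1)   ≤⟨ ∑-mono-≤ pointwise ⟩
    ∑[ y < n ] L y                    ≡⟨ ∑-distrib-+ (Σunless B db) (Σunless A da) ⟩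
    ∑ (Σunless B db) + ∑ (Σunless A da) ≤⟨ +-mono-≤ B-nonimproving A-nonimproving ⟩
    ∑ (Σunless B da) + ∑ (Σunless A db) ≡⟨ sym (∑-distrib-+ (Σunless B da) (Σunless A db)) ⟩
    ∑[ y < n ] R y                    ≡⟨ sym (+-identityʳ _) ⟩
    ∑[ y < n ] R y + 0                ∎))
  where
  open ≤-Reasoning
  ∑ : (Fin n → ℕ) → ℕ
  ∑ f = ∑[ y < n ] f y
  Σunless : (Fin n → Bool) → (Fin n → ℕ) → Fin n → ℕ
  Σunless P f y = unless (P y) (f y)
  L R : Fin n → ℕ
  L y = unless (B y) (db y) + unless (A y) (da y)
  R y = unless (B y) (da y) + unless (A y) (db y)
  pointwise : ∀ y → R y + when (B y) 1 ≤ L y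
  pointwise y with A y in ay | B y in by
  ... | false | false = ≤-reflexive (trans (+-identityʳ _) (+-comm (da y) (db y)))
  ... | true  | false = begin
    (da y + 0) + 0 ≡⟨ trans (+-identityʳ _) (+-identityʳ _) ⟩
    da y           ≤⟨ m≤n+m (da y) δ ⟩
    δ + da y       ≡⟨ sym (A⇒ ay) ⟩
    db y           ≡⟨ sym (+-identityʳ _) ⟩
    db y + 0       ∎
  ... | false | true  = begin
    db y + 1       ≡⟨ +-comm (db y) 1 ⟩
    suc (db y)     ≤⟨ +-monoˡ-≤ (db y) δ>0 ⟩
    δ + db y       ≡⟨ sym (B⇒ by) ⟩
    da y           ∎
  ... | true  | true  = ⊥-elim (<⇒≢ δ>0 (sym (m+n≡0⇒m≡0 δ (+-cancelʳ-≡ (db y) (δ + δ) 0 2δ+db≡db))))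
    where
    2δ+db≡db : (δ + δ) + db y ≡ 0 + db y
    2δ+db≡db = begin-equality
      (δ + δ) + db y ≡⟨ +-assoc δ δ (db y) ⟩
      δ + (δ + db y) ≡⟨ cong (δ +_) (sym (B⇒ by)) ⟩
      δ + da y       ≡⟨ sym (A⇒ ay) ⟩
      db y           ∎

module _ {c : Fin n} {S : Subset n} where

  starEdge⁻ : ∀ {x y} → starEdge c S x y ≡ true → (x ≡ c × y ∈ S) ⊎ (y ≡ c × x ∈ S)
  starEdge⁻ {x} {y} e with x ≟ c | y ∈? S | y ≟ c | x ∈? S
  ... | yes x≡c | yes y∈S | _       | _       = inj₁ (x≡c , y∈S)
  ... | _       | _       | yes y≡c | yes x∈S = inj₂ (y≡c , x∈S)
  ... | yes _   | no _    | yes _   | no _    with () ← e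
  ... | yes _   | no _    | no _    | _       with () ← e
  ... | no _    | _       | yes _   | no _    with () ← e
  ... | no _    | _       | no _    | _       with () ← e

  starEdge-centre : ∀ {y} → y ∈ S → starEdge c S c y ≡ true
  starEdge-centre {y} y∈S rewrite dec-true⁺ (c ≟ c) refl | dec-true⁺ (y ∈? S) y∈S = refl

  starEdge-leaf : ∀ {x} → x ∈ S → starEdge c S x c ≡ true
  starEdge-leaf {x} x∈S rewrite dec-true⁺ (c ≟ c) refl | dec-true⁺ (x ∈? S) x∈S = ∨-zeroʳ _

  starEdge-sym : ∀ x y → starEdge c S x y ≡ starEdge c S y x
  starEdge-sym x y = ∨-comm (⌊ x ≟ c ⌋ ∧ ⌊ y ∈? S ⌋) _

module _ {T : Adj n} {c₁ c₂ : Fin n} {S : Subset n} where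

  moveStar⁻ : ∀ {x y} → Edge (moveStar T c₁ c₂ S) x y →
              (Edge T x y × starEdge c₁ S x y ≡ false) ⊎ starEdge c₂ S x y ≡ true
  moveStar⁻ {x} {y} e with T x y | starEdge c₁ S x y | starEdge c₂ S x y
  ... | _     | _     | true  = inj₂ refl
  ... | true  | false | false = inj₁ (refl , refl)
  ... | true  | true  | false with () ← e
  ... | false | _     | false with () ← e

  moveStar-kept : ∀ {x y} → Edge T x y → starEdge c₁ S x y ≡ false → Edge (moveStar T c₁ c₂ S) x y
  moveStar-kept e ¬star rewrite e | ¬star = refl

  moveStar-added : ∀ {x y} → starEdge c₂ S x y ≡ true → Edge (moveStar T c₁ c₂ S) x y
  moveStar-added star rewrite star = ∨-zeroʳ _

  moveStar-undirected : Undirected T → Undirected (moveStar T c₁ c₂ S)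
  moveStar-undirected undirected x y
    rewrite undirected x y | starEdge-sym {c = c₁} {S} x y | starEdge-sym {c = c₂} {S} x y = refl

module MoveStar {T : Adj n} (tree : IsTree T) (a b : Fin n) (S : Subset n)
                (S⊆N[b] : ∀ v → v ∈ S → Edge T b v)
                (a-in-front : ∀ v → v ∈ S → dist T a b ≢ suc (dist T a v)) where

  open Tree tree

  -- x lies behind v ∈ S: the x–b path in T enters b through v.
  Behind : Fin n → Fin n → Set
  Behind x v = v ∈ S × d x b ≡ suc (d x v)

  behind? : ∀ x → Dec (∃ (Behind x))
  behind? x = any? λ v → v ∈? S ×-dec d x b ℕ.≟ suc (d x v)

  -- Opaque, so that with-abstraction over behind x sees a rigid term.
  opaque
    behind : Fin n → Bool
    behind x = ⌊ behind? x ⌋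

    behind-true⁺ : ∀ {x v} → Behind x v → behind x ≡ true
    behind-true⁺ {x} {v} bx = dec-true⁺ (behind? x) (v , bx)

    behind-true⁻ : ∀ {x} → behind x ≡ true → ∃ (Behind x)
    behind-true⁻ {x} eq = toWitness {a? = behind? x} (Equivalence.from T-≡ eq)

  behind-false⁻ : ∀ {x v} → behind x ≡ false → ¬ Behind x v
  behind-false⁻ eq bx with () ← trans (sym (behind-true⁺ bx)) eq

  behind-false⁺ : ∀ {x} → (∀ v → ¬ Behind x v) → behind x ≡ false
  behind-false⁺ {x} ¬bx with behind x in eq
  ... | false = refl
  ... | true  = let v , bx = behind-true⁻ eq in ⊥-elim (¬bx v bx)

  d[S,b] : ∀ {v} → v ∈ S → d v b ≡ 1
  d[S,b] v∈S = d-adjacent (flip-edge undirected (S⊆N[b] _ v∈S))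

  behind-self : ∀ {v} → v ∈ S → Behind v v
  behind-self {v} v∈S = v∈S , trans (d[S,b] v∈S) (cong suc (sym (dist-self v)))

  b-not-behind : behind b ≡ false
  b-not-behind = behind-false⁺ λ v (_ , eq) → 0≢1+n (trans (sym (dist-self b)) eq)

  a-not-behind : behind a ≡ false
  a-not-behind = behind-false⁺ λ v (v∈S , eq) → a-in-front v v∈S eq

  a∉S : a ∉ S
  a∉S a∈S = a-in-front a a∈S (trans (d[S,b] a∈S) (cong suc (sym (dist-self a))))

  behind-step : ∀ {x v z} → Behind x v → Edge T x z → z ≢ b → Behind z v
  behind-step {x} {v} {z} (v∈S , x-behind) exz z≢b with edge-level b exz
  ... | inj₂ z-farther = v∈S , trans z-farther (cong suc (≤-antisym dxb≤dzv dzv≤dxb))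
    where
    dzv≤dxb : d z v ≤ d x b
    dzv≤dxb = subst (d z v ≤_) (sym x-behind) (d-edge v (flip-edge undirected exz))
    dxb≤dzv : d x b ≤ d z v
    dxb≤dzv = ≤-pred (begin
      suc (d x b)  ≡⟨ sym z-farther ⟩
      d z b        ≤⟨ d-triangle z v b ⟩
      d z v + d v b ≡⟨ cong (d z v +_) (d[S,b] v∈S) ⟩
      d z v + 1    ≡⟨ +-comm (d z v) 1 ⟩
      suc (d z v)  ∎)
      where open ≤-Reasoning
  -- Here z is x's parent towards b, and so is x's first step y towards v; hence z = y.
  ... | inj₁ z-closer with x ≟ v
  ...   | yes refl = ⊥-elim (z≢b (d≡0⇒≡ (suc-injective (trans (sym z-closer) (d[S,b] v∈S)))))
  ...   | no x≢v with d-step x≢v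
  ...     | y , exy , y-closer-v = v∈S , (begin
      d z b       ≡⟨ suc-injective (trans (sym z-closer) x-behind) ⟩
      d x v       ≡⟨ y-closer-v ⟩
      suc (d y v) ≡⟨ cong (λ w → suc (d w v)) (sym z≡y) ⟩
      suc (d z v) ∎)
    where
    open ≡-Reasoning
    dyb≤dxv : d y b ≤ d x v
    dyb≤dxv = ≤-trans (d-triangle y v b)
                (≤-reflexive (trans (cong (d y v +_) (d[S,b] v∈S)) (trans (+-comm (d y v) 1) (sym y-closer-v))))
    dxv≤dyb : d x v ≤ d y b
    dxv≤dyb = ≤-pred (subst (_≤ suc (d y b)) x-behind (d-edge b exy))
    z≡y : z ≡ y
    z≡y = parent-unique b exz exy z-closer (trans x-behind (cong suc (≤-antisym dxv≤dyb dyb≤dxv)))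

  behind-exit : ∀ {x v z} → Behind x v → Edge T x z → ¬ Behind z v → z ≡ b × x ≡ v
  behind-exit {z = z} bx@(_ , x-behind) exz ¬bz with z ≟ b
  ... | yes refl = refl , d≡0⇒≡ (suc-injective (trans (sym x-behind) (d-adjacent exz)))
  ... | no z≢b   = ⊥-elim (¬bz (behind-step bx exz z≢b))

  d-through-b : ∀ {x v y} → Behind x v → ¬ Behind y v → d x y ≡ d x b + d b y
  d-through-b {x} {v} {y} bx ¬by = ≤-antisym (d-triangle x b y) (walk-length bx (geodesic x y))
    where
    walk-length : ∀ {x L} → Behind x v → Walk T x y L → d x b + d b y ≤ L
    walk-length bx ε = ⊥-elim (¬by bx)
    walk-length bx (_◅_ {w = z} e w) with z ≟ b
    ... | yes refl = subst (λ k → k + d b y ≤ _) (sym (d-adjacent e)) (s≤s (dist-≤-walk w))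
    ... | no z≢b   = ≤-trans (+-monoˡ-≤ (d b y) (d-edge b e)) (s≤s (walk-length (behind-step bx e z≢b) w))

  d-a-behind : ∀ {y v} → Behind y v → d a y ≡ d a b + d b y
  d-a-behind {y} {v} by = begin
    d a y         ≡⟨ d-sym a y ⟩
    d y a         ≡⟨ d-through-b by (behind-false⁻ a-not-behind) ⟩
    d y b + d b a ≡⟨ +-comm (d y b) (d b a) ⟩
    d b a + d y b ≡⟨ cong₂ _+_ (d-sym b a) (d-sym y b) ⟩
    d a b + d b y ∎
    where open ≡-Reasoning

  T′ : Adj n
  T′ = moveStar T b a S

  leaving-edge : ∀ {x z} → behind x ≡ true → behind z ≡ false → Edge T x z → x ∈ S × z ≡ b
  leaving-edge bx bz exz =
    let v , bxv = behind-true⁻ bx ; z≡b , x≡v = behind-exit bxv exz (behind-false⁻ bz)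
    in subst (_∈ S) (sym x≡v) (proj₁ bxv) , z≡b

  side-preserved : ∀ {x z} → Edge T x z → starEdge b S x z ≡ false → behind x ≡ behind z
  side-preserved {x} {z} exz ¬star with behind x in bx | behind z in bz
  ... | false | false = refl
  ... | true  | true  = refl
  ... | true  | false with x∈S , refl ← leaving-edge bx bz exz
    with () ← trans (sym (starEdge-leaf {c = b} x∈S)) ¬star
  ... | false | true  with z∈S , refl ← leaving-edge bz bx (flip-edge undirected exz)
    with () ← trans (sym (starEdge-centre {c = b} z∈S)) ¬star

  T′-edge⁻ : ∀ {x z} → Edge T′ x z →
             (Edge T x z × behind x ≡ behind z) ⊎ (x ≡ a × z ∈ S) ⊎ (z ≡ a × x ∈ S)
  T′-edge⁻ {x} {z} e with moveStar⁻ {T = T} {b} {a} {S} {x} {z} e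
  ... | inj₁ (exz , ¬star) = inj₁ (exz , side-preserved exz ¬star)
  ... | inj₂ star          = inj₂ (starEdge⁻ {c = a} {S} {x} {z} star)

  kept-edge : ∀ {x z} → Edge T x z → behind x ≡ behind z → Edge T′ x z
  kept-edge {x} {z} exz same = moveStar-kept {T = T} {b} {a} {S} exz not-star
    where
    not-star : starEdge b S x z ≡ false
    not-star with starEdge b S x z in star
    ... | false = refl
    ... | true with starEdge⁻ {c = b} {S} {x} {z} star
    ...   | inj₁ (refl , z∈S)
      with () ← trans (sym (behind-true⁺ (behind-self z∈S))) (trans (sym same) b-not-behind)
    ...   | inj₂ (refl , x∈S)
      with () ← trans (sym (behind-true⁺ (behind-self x∈S))) (trans same b-not-behind)

  new-edge : ∀ {v} → v ∈ S → Edge T′ a v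
  new-edge {v} v∈S = moveStar-added {T = T} {b} {a} {S} {a} {v} (starEdge-centre v∈S)

  new-edge′ : ∀ {v} → v ∈ S → Edge T′ v a
  new-edge′ {v} v∈S = moveStar-added {T = T} {b} {a} {S} {v} {a} (starEdge-leaf v∈S)

  -- δ (behind x) (behind y) x y turns out to be dist T′ x y: as in T within a side, and between
  -- the sides via the new edge joining a to the S-vertex on the x–b (or y–b) path.
  δ : Bool → Bool → Fin n → Fin n → ℕ
  δ true  false x y = d x b + d a y
  δ false true  x y = d x a + d b y
  δ _     _     x y = d x y

  D : Fin n → Fin n → ℕ
  D x y = δ (behind x) (behind y) x y

  D-target : ∀ y → D y y ≡ 0
  D-target y with behind y
  ... | true  = dist-self y
  ... | false = dist-self y

  kept-lipschitz : ∀ p q {x z} y → Edge T x z → δ p q x y ≤ suc (δ p q z y)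
  kept-lipschitz true  true  y e = d-edge y e
  kept-lipschitz true  false y e = +-monoˡ-≤ (d a y) (d-edge b e)
  kept-lipschitz false true  y e = +-monoˡ-≤ (d b y) (d-edge a e)
  kept-lipschitz false false y e = d-edge y e

  new-lipschitz : ∀ q {v} y → v ∈ S →
                  δ false q a y ≤ suc (δ true q v y) × δ true q v y ≤ suc (δ false q a y)
  new-lipschitz true  {v} y v∈S rewrite dist-self {H = T} a =
    d-edge y (S⊆N[b] v v∈S) , d-edge y (flip-edge undirected (S⊆N[b] v v∈S))
  new-lipschitz false {v} y v∈S rewrite d[S,b] v∈S = m≤n⇒m≤1+n (n≤1+n (d a y)) , ≤-refl

  D-lipschitz : ∀ y {x z} → Edge T′ x z → D x y ≤ suc (D z y)
  D-lipschitz y {x} {z} e with T′-edge⁻ e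
  ... | inj₁ (exz , same) =
    subst (λ p → D x y ≤ suc (δ p (behind y) z y)) same (kept-lipschitz (behind x) (behind y) y exz)
  ... | inj₂ (inj₁ (refl , z∈S)) rewrite a-not-behind | behind-true⁺ (behind-self z∈S) =
    proj₁ (new-lipschitz (behind y) y z∈S)
  ... | inj₂ (inj₂ (refl , x∈S)) rewrite a-not-behind | behind-true⁺ (behind-self x∈S) =
    proj₂ (new-lipschitz (behind y) y x∈S)

  δ[a,behind] : ∀ {y} → behind y ≡ true → δ (behind a) true a y ≡ d b y
  δ[a,behind] _ rewrite a-not-behind | dist-self {H = T} a = refl

  δ[a,outside] : ∀ {y} → behind y ≡ false → δ (behind a) false a y ≡ d a y
  δ[a,outside] _ rewrite a-not-behind = refl

  δ-side : ∀ {z p} q y → behind z ≡ p → δ (behind z) q z y ≡ δ p q z y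
  δ-side q y bz = cong (λ p → δ p q _ y) bz

  descent-outside : ∀ {x y} → behind x ≡ false → behind y ≡ false → x ≢ y →
                    ∃ λ z → Edge T′ x z × d x y ≡ suc (δ (behind z) false z y)
  descent-outside {x} {y} bx by x≢y with d-step x≢y
  ... | z , exz , dz with behind z in bz
  ...   | false = z , kept-edge exz (trans bx (sym bz)) , trans dz (cong suc (sym (δ-side false y bz)))
  ...   | true with z∈S , refl ← leaving-edge bz bx (flip-edge undirected exz) =
    ⊥-elim (behind-false⁻ by (z∈S , trans (d-sym y b) (trans dz (cong suc (d-sym z y)))))

  descent-behind : ∀ {x y} → behind x ≡ true → behind y ≡ true → x ≢ y →
                   ∃ λ z → Edge T′ x z × d x y ≡ suc (δ (behind z) true z y)
  descent-behind {x} {y} bx by x≢y with d-step x≢y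
  ... | z , exz , dz with behind z in bz
  ...   | true  = z , kept-edge exz (trans bx (sym bz)) , trans dz (cong suc (sym (δ-side true y bz)))
  ...   | false with x∈S , refl ← leaving-edge bx bz exz =
    a , new-edge′ x∈S , trans dz (cong suc (sym (δ[a,behind] by)))

  descent-leaving : ∀ {x y} → behind x ≡ true → behind y ≡ false →
                    ∃ λ z → Edge T′ x z × d x b + d a y ≡ suc (δ (behind z) false z y)
  descent-leaving {x} {y} bx by with d-step {x} {b} x≢b
    where
    x≢b : x ≢ b
    x≢b refl with () ← trans (sym bx) b-not-behind
  ... | z , exz , dz with behind z in bz
  ...   | true  = z , kept-edge exz (trans bx (sym bz)) ,
                  trans (cong (_+ d a y) dz) (cong suc (sym (δ-side false y bz)))
  ...   | false with x∈S , refl ← leaving-edge bx bz exz =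
    a , new-edge′ x∈S , trans (cong (_+ d a y) (d[S,b] x∈S)) (cong suc (sym (δ[a,outside] by)))

  descent-entering : ∀ {x y} → behind x ≡ false → behind y ≡ true →
                     ∃ λ z → Edge T′ x z × d x a + d b y ≡ suc (δ (behind z) true z y)
  -- Split on a ≟ x, not x ≟ a: the latter also occurs inside the normalised goal Edge T′ x z.
  descent-entering {x} {y} bx by with a ≟ x
  ... | yes refl with v , (v∈S , y-behind) ← behind-true⁻ by =
    v , new-edge v∈S , (begin
      d a a + d b y             ≡⟨ cong (_+ d b y) (dist-self a) ⟩
      d b y                     ≡⟨ d-sym b y ⟩
      d y b                     ≡⟨ y-behind ⟩
      suc (d y v)               ≡⟨ cong suc (d-sym y v) ⟩
      suc (d v y)               ≡⟨ cong suc (sym (δ-side true y (behind-true⁺ (behind-self v∈S)))) ⟩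
      suc (δ (behind v) true v y) ∎)
    where open ≡-Reasoning
  ... | no a≢x with d-step (a≢x ∘ sym)
  ...   | z , exz , dz with behind z in bz
  ...     | false = z , kept-edge exz (trans bx (sym bz)) ,
                    trans (cong (_+ d b y) dz) (cong suc (sym (δ-side true y bz)))
  ...     | true with z∈S , refl ← leaving-edge bz bx (flip-edge undirected exz) =
    ⊥-elim (a-in-front z z∈S (trans (d-sym a b) (trans dz (cong suc (d-sym z a)))))

  D-descent : ∀ y {x} → x ≢ y → ∃ λ z → Edge T′ x z × D x y ≡ suc (D z y)
  D-descent y {x} x≢y with behind x in bx | behind y in by
  ... | false | false = descent-outside bx by x≢y
  ... | true  | true  = descent-behind bx by x≢y
  ... | true  | false = descent-leaving bx by
  ... | false | true  = descent-entering bx by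

  dist-T′ : ∀ x y → dist T′ x y ≡ D x y
  dist-T′ x y = dist≡potential y (λ x → D x y) (D-target y) (D-lipschitz y) (D-descent y) x

  T′-walkConnected : WalkConnected T′
  T′-walkConnected x y = D x y , potential-walk y (λ x → D x y) (D-target y) (D-lipschitz y) (D-descent y) x

  height : Fin n → ℕ
  height x = if behind x then d x b else d x a

  height-behind : ∀ {x} → behind x ≡ true → height x ≡ d x b
  height-behind bx rewrite bx = refl

  height-outside : ∀ {x} → behind x ≡ false → height x ≡ d x a
  height-outside bx rewrite bx = refl

  height-a : height a ≡ 0
  height-a = trans (height-outside a-not-behind) (dist-self a)

  height-S : ∀ {v} → v ∈ S → height v ≡ 1
  height-S v∈S = trans (height-behind (behind-true⁺ (behind-self v∈S))) (d[S,b] v∈S)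

  T′-edge-level : ∀ {x z} → Edge T′ x z → height x ≡ suc (height z) ⊎ height z ≡ suc (height x)
  T′-edge-level e with T′-edge⁻ e
  ... | inj₂ (inj₁ (refl , z∈S)) = inj₂ (trans (height-S z∈S) (cong suc (sym height-a)))
  ... | inj₂ (inj₂ (refl , x∈S)) = inj₁ (trans (height-S x∈S) (cong suc (sym height-a)))
  ... | inj₁ (exz , same) = kept-edge-level exz same
    where
    kept-edge-level : ∀ {x z} → Edge T x z → behind x ≡ behind z →
                      height x ≡ suc (height z) ⊎ height z ≡ suc (height x)
    kept-edge-level {x} {z} exz same with behind x in bx | behind z in bz
    ... | true  | true  = edge-level b exz
    ... | false | false = edge-level a exz
    ... | true  | false with () ← same
    ... | false | true  with () ← same

  kept-parent-unique : ∀ {x y z} → Edge T x y → Edge T x z → behind x ≡ behind y → behind x ≡ behind z →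
                       height x ≡ suc (height y) → height x ≡ suc (height z) → y ≡ z
  kept-parent-unique {x} {y} {z} exy exz sy sz hy hz with behind x in bx
  ... | true  = parent-unique b exy exz (trans hy (cong suc (height-behind (sym sy))))
                                        (trans hz (cong suc (height-behind (sym sz))))
  ... | false = parent-unique a exy exz (trans hy (cong suc (height-outside (sym sy))))
                                        (trans hz (cong suc (height-outside (sym sz))))

  T′-edge-from : ∀ {x y} → x ≢ a → Edge T′ x y →
                 (Edge T x y × behind x ≡ behind y) ⊎ (y ≡ a × x ∈ S)
  T′-edge-from x≢a e with T′-edge⁻ e
  ... | inj₁ kept                  = inj₁ kept
  ... | inj₂ (inj₁ (x≡a , _))     = ⊥-elim (x≢a x≡a)
  ... | inj₂ (inj₂ new)           = inj₂ new

  S-has-no-kept-parent : ∀ {x y} → x ∈ S → behind x ≡ behind y → height x ≢ suc (height y)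
  S-has-no-kept-parent {x} {y} x∈S same hy =
    true≢false (trans (sym (subst (λ w → behind w ≡ true) y≡b by)) b-not-behind)
    where
    by : behind y ≡ true
    by = trans (sym same) (behind-true⁺ (behind-self x∈S))
    y≡b : y ≡ b
    y≡b = d≡0⇒≡ (trans (sym (height-behind by)) (suc-injective (trans (sym hy) (height-S x∈S))))

  T′-parent-unique : ∀ {x y z} → Edge T′ x y → Edge T′ x z →
                     height x ≡ suc (height y) → height x ≡ suc (height z) → y ≡ z
  T′-parent-unique {x} {y} {z} exy exz hy hz with a ≟ x
  ... | yes refl = ⊥-elim (0≢1+n (trans (sym height-a) hy))
  ... | no a≢x with T′-edge-from (a≢x ∘ sym) exy | T′-edge-from (a≢x ∘ sym) exz
  ...   | inj₂ (refl , _)    | inj₂ (refl , _)    = refl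
  ...   | inj₁ (_ , sy)      | inj₂ (_ , x∈S)     = ⊥-elim (S-has-no-kept-parent x∈S sy hy)
  ...   | inj₂ (_ , x∈S)     | inj₁ (_ , sz)      = ⊥-elim (S-has-no-kept-parent x∈S sz hz)
  ...   | inj₁ (exy′ , sy)   | inj₁ (exz′ , sz)   = kept-parent-unique exy′ exz′ sy sz hy hz

  T′-graded : Graded T′ height
  T′-graded = record { edge-level = T′-edge-level ; parent-unique = T′-parent-unique }

  T′-undirected : Undirected T′
  T′-undirected = moveStar-undirected {T = T} {b} {a} {S} undirected

  T′-loopless : ∀ x → T′ x x ≡ false
  T′-loopless x with T′ x x in e
  ... | false = refl
  ... | true with T′-edge⁻ e
  ...   | inj₁ (exx , _)           with () ← trans (sym exx) (loopless x)
  ...   | inj₂ (inj₁ (refl , a∈S)) = ⊥-elim (a∉S a∈S)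
  ...   | inj₂ (inj₂ (refl , a∈S)) = ⊥-elim (a∉S a∈S)

  T′-tree : IsTree T′
  T′-tree = (T′-undirected , T′-loopless) , walkConnected⇒connected T′-walkConnected ,
            graded⇒acyclic T′-undirected T′-graded

  T′-spanning : ∀ {G} → (∀ x y → Edge T x y → Edge G x y) → Undirected G →
                (∀ v → v ∈ S → Edge G v a) →
                IsSpanningTree G T′
  T′-spanning {G} T⊆G G-undirected S-a = T′⊆G , T′-tree
    where
    T′⊆G : ∀ x y → Edge T′ x y → Edge G x y
    T′⊆G x y e with T′-edge⁻ e
    ... | inj₁ (exy , _)           = T⊆G x y exy
    ... | inj₂ (inj₁ (refl , y∈S)) = flip-edge G-undirected (S-a y y∈S)
    ... | inj₂ (inj₂ (refl , x∈S)) = S-a x x∈S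

  outside : (Fin n → ℕ) → Fin n → ℕ
  outside f y = unless (behind y) (f y)

  Σoutside : (Fin n → ℕ) → ℕ
  Σoutside f = ∑[ y < n ] outside f y

  cross : (Fin n → ℕ) → Fin n → Fin n → ℕ
  cross f x y = when (behind x) (outside f y) + when (behind y) (outside f x)

  cross-identity : ∀ x y → D x y + cross (d b) x y ≡ d x y + cross (d a) x y
  cross-identity x y with behind x in bx | behind y in by
  ... | true  | true  = refl
  ... | false | false = refl
  ... | true  | false = begin
    (d x b + d a y) + (d b y + 0) ≡⟨ cong ((d x b + d a y) +_) (+-identityʳ (d b y)) ⟩
    (d x b + d a y) + d b y       ≡⟨ xy∙z≈xz∙y (d x b) (d a y) (d b y) ⟩
    (d x b + d b y) + d a y       ≡⟨ cong₂ _+_ (sym (d-through-b (proj₂ (behind-true⁻ bx))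
                                                             (behind-false⁻ by)))
                                               (sym (+-identityʳ (d a y))) ⟩
    d x y + (d a y + 0)           ∎
    where open ≡-Reasoning
  ... | false | true  = begin
    (d x a + d b y) + (0 + d b x) ≡⟨ cong₂ _+_ (cong₂ _+_ (d-sym x a) (d-sym b y)) refl ⟩
    (d a x + d y b) + d b x       ≡⟨ xy∙z≈yz∙x (d a x) (d y b) (d b x) ⟩
    (d y b + d b x) + d a x       ≡⟨ cong (_+ d a x) (sym (trans (d-sym x y)
                                       (d-through-b (proj₂ (behind-true⁻ by)) (behind-false⁻ bx)))) ⟩
    d x y + (0 + d a x)           ∎
    where open ≡-Reasoning

  ∑∑-cross : ∀ f → ∑∑ (cross f) ≡ count behind * Σoutside f + count behind * Σoutside f
  ∑∑-cross f = begin
    ∑∑ (cross f)                          ≡⟨ ∑∑-distrib-+ straight swapped ⟩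
    ∑∑ straight + ∑∑ swapped              ≡⟨ cong (∑∑ straight +_) (∑-comm swapped) ⟩
    ∑∑ straight + ∑∑ (λ y x → swapped x y) ≡⟨ cong₂ _+_ (∑∑-when behind (outside f)) (∑∑-when behind (outside f)) ⟩
    count behind * Σoutside f + count behind * Σoutside f ∎
    where
    open ≡-Reasoning
    straight swapped : Fin n → Fin n → ℕ
    straight x y = when (behind x) (outside f y)
    swapped x y = when (behind y) (outside f x)

  -- That is, W T′ − W T = |B| · Σ_{y ∉ B} (d a y − d b y), written without truncated subtraction.
  Wiener-moveStar : W T′ + count behind * Σoutside (d b) ≡ W T + count behind * Σoutside (d a)
  Wiener-moveStar = +-double-injective (begin
    (W T′ + βΣ (d b)) + (W T′ + βΣ (d b)) ≡⟨ interchange (W T′) (βΣ (d b)) (W T′) (βΣ (d b)) ⟩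
    (W T′ + W T′) + (βΣ (d b) + βΣ (d b)) ≡⟨ cong₂ _+_ (W-doubled T′-undirected T′-walkConnected)
                                                      (sym (∑∑-cross (d b))) ⟩
    ∑∑ (dist T′) + ∑∑ (cross (d b))       ≡⟨ sym (∑∑-distrib-+ (dist T′) (cross (d b))) ⟩
    ∑∑ (λ x y → dist T′ x y + cross (d b) x y)
      ≡⟨ sum-cong-≗ (λ x → sum-cong-≗ (λ y →
           trans (cong (_+ cross (d b) x y) (dist-T′ x y)) (cross-identity x y))) ⟩
    ∑∑ (λ x y → d x y + cross (d a) x y)  ≡⟨ ∑∑-distrib-+ d (cross (d a)) ⟩
    ∑∑ d + ∑∑ (cross (d a))               ≡⟨ cong₂ _+_ (sym (W-doubled undirected walkConnected))
                                                      (∑∑-cross (d a)) ⟩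
    (W T + W T) + (βΣ (d a) + βΣ (d a))   ≡⟨ interchange (W T) (W T) (βΣ (d a)) (βΣ (d a)) ⟩
    (W T + βΣ (d a)) + (W T + βΣ (d a))   ∎)
    where
    open ≡-Reasoning
    βΣ : (Fin n → ℕ) → ℕ
    βΣ f = count behind * Σoutside f

  count-behind-pos : ∀ {v} → v ∈ S → 0 < count behind
  count-behind-pos v∈S = count-pos behind (behind-true⁺ (behind-self v∈S))

  Wiener-nondecreasing : ∀ {v} → v ∈ S → W T ≤ W T′ → Σoutside (d b) ≤ Σoutside (d a)
  Wiener-nondecreasing v∈S W≤W′ =
    *-cancelˡ-≤ (count behind) {{>-nonZero (count-behind-pos v∈S)}} (+-cancelˡ-≤ (W T) _ _ (begin
      W T + count behind * Σoutside (d b)  ≤⟨ +-monoˡ-≤ _ W≤W′ ⟩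
      W T′ + count behind * Σoutside (d b) ≡⟨ Wiener-moveStar ⟩
      W T + count behind * Σoutside (d a)  ∎))
    where open ≤-Reasoning

lemma2 : ∀ {n : ℕ} (G : Adj n) (a b : Fin n) (Va Vb : Subset n) (T : Adj n) →
    IsSimple G → a ≢ b → Nonempty Va → Nonempty Vb →
    (∀ v → v ∈ Va ∪ Vb → G v a ≡ true × G v b ≡ true) →
    IsSpanningTree G T →
    (∀ v → v ∈ Va → T a v ≡ true) →
    (∀ v → v ∈ Vb → T b v ≡ true) →
    (∀ (p : List (Fin n)) → IsPath T a b p → All (λ v → v ∉ Va ∪ Vb) p) →
    IsSpanningTree G (moveStar T b a Vb) × IsSpanningTree G (moveStar T a b Va) ×
      (W (moveStar T b a Vb) ⊓ W (moveStar T a b Va) < W T)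
lemma2 G a b Va Vb T (G-undirected , _) a≢b (va , va∈Va) (vb , vb∈Vb) Va∪Vb⊆N[a,b] (T⊆G , tree)
       Va⊆N[a] Vb⊆N[b] a-b-paths-avoid =
  M₁.T′-spanning T⊆G G-undirected (λ v → proj₁ ∘ Va∪Vb⊆N[a,b] v ∘ x∈p∪q⁺ ∘ inj₂) ,
  M₂.T′-spanning T⊆G G-undirected (λ v → proj₂ ∘ Va∪Vb⊆N[a,b] v ∘ x∈p∪q⁺ ∘ inj₁) ,
  decidable-stable (_ ℕ.<? _) λ no-decrease → let W≤min = ≮⇒≥ no-decrease in
    no-double-improvement (d a) (d b) M₂.behind M₁.behind (n≢0⇒n>0 (a≢b ∘ d≡0⇒≡))
      (λ by → trans (M₂.d-a-behind (proj₂ (M₂.behind-true⁻ by))) (cong (_+ _) (d-sym b a)))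
      (λ by → M₁.d-a-behind (proj₂ (M₁.behind-true⁻ by)))
      (M₁.count-behind-pos vb∈Vb)
      (M₁.Wiener-nondecreasing vb∈Vb (≤-trans W≤min (m⊓n≤m _ _)))
      (M₂.Wiener-nondecreasing va∈Va (≤-trans W≤min (m⊓n≤n _ _)))
  where
  open Tree tree
  avoided : ∀ {v p} → IsPath T a b p → v ∈ₗ p → v ∉ Va ∪ Vb
  avoided path v∈p = All.lookup (a-b-paths-avoid _ path) v∈p
  a-in-front : ∀ v → v ∈ Vb → d a b ≢ suc (d a v)
  a-in-front v v∈Vb eq =
    let _ , path , v∈p = path-via-last (flip-edge undirected (Vb⊆N[b] v v∈Vb)) eq
    in avoided path v∈p (x∈p∪q⁺ (inj₂ v∈Vb))
  b-in-front : ∀ v → v ∈ Va → d b a ≢ suc (d b v)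
  b-in-front v v∈Va eq =
    let _ , path , v∈p = path-via-first (Va⊆N[a] v v∈Va) (trans (d-sym a b) (trans eq (cong suc (d-sym b v))))
    in avoided path v∈p (x∈p∪q⁺ (inj₁ v∈Va))
  module M₁ = MoveStar tree a b Vb Vb⊆N[b] a-in-front
  module M₂ = MoveStar tree b a Va Va⊆N[a] b-in-front
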